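{- If a round graph is not co-connected, then it is co-bipartite.
   Context: An ordered semiblock family is a sequence $\mathcal{B}=B_1,\dots,B_k$ of pairwise disjoint nonempty sets; indices modulo $k$, and $[B_i,B_j]$ denotes $B_i,B_{i+1},\dots,B_j$ (indices modulo $k$). A round representation is a pair $\Phi=(\mathcal{B},F_r)$ with $F_r:\mathcal{B}\to\mathcal{B}$ such that $F_r(B_i)\in[B_i,F_r(B_{i+1})]$ for all $i$; write $B\to W$ when $W\in[B,F_r(B)]$ and $W\neq B$. Round representations are normal: never both $B\to W$ and $W\to B$. A round graph is a graph (on a semiblock family) that is the round graph $\mathcal{G}(\Phi)$ of some round representation $\Phi$: vertex set $\mathcal{B}$, with $B,W$ adjacent iff $B\to W$ or $W\to B$. A graph is co-connected if its complement is connected, and co-bipartite if its complement is bipartite (one side of the bipartition may be empty). -}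

module Defs where

open import Data.Nat using (ℕ; suc; _+_; _∸_; _≤_; _%_)
open import Data.Fin using (Fin; toℕ; fromℕ<)
open import Data.Nat.DivMod using (m%n<n)
open import Data.Bool using (Bool)
open import Data.Product using (Σ; _×_; ∃)
open import Data.Sum using (_⊎_)
open import Relation.Nullary using (¬_)
open import Relation.Binary.PropositionalEquality using (_≡_; _≢_)

-- Semiblocks B_0,…,B_{k-1} of an ordered semiblock family are represented by
-- their positions Fin k (k = suc n ≥ 1); the graph only depends on positions.

next : ∀ {n} → Fin (suc n) → Fin (suc n)
next {n} i = fromℕ< (m%n<n (suc (toℕ i)) (suc n))

cdist : ∀ {n} → Fin (suc n) → Fin (suc n) → ℕ
cdist {n} i w = (toℕ w + suc n ∸ toℕ i) % suc n

InInterval : ∀ {n} → Fin (suc n) → Fin (suc n) → Fin (suc n) → Set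
InInterval i j w = cdist i w ≤ cdist i j

Arrow : ∀ {n} → (Fin (suc n) → Fin (suc n)) → Fin (suc n) → Fin (suc n) → Set
Arrow F b w = InInterval b (F b) w × w ≢ b

record RoundRep (n : ℕ) : Set where
  field
    Fr     : Fin (suc n) → Fin (suc n)
    round  : ∀ i → InInterval i (Fr (next i)) (Fr i)
    normal : ∀ b w → ¬ (Arrow Fr b w × Arrow Fr w b)

Adj : ∀ {n} → RoundRep n → Fin (suc n) → Fin (suc n) → Set
Adj Φ b w = Arrow (RoundRep.Fr Φ) b w ⊎ Arrow (RoundRep.Fr Φ) w b

CoAdj : ∀ {n} → (Fin (suc n) → Fin (suc n) → Set) → Fin (suc n) → Fin (suc n) → Set
CoAdj E u v = u ≢ v × ¬ E u v

data Reach {n} (E : Fin (suc n) → Fin (suc n) → Set) : Fin (suc n) → Fin (suc n) → Set where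
  here : ∀ {u} → Reach E u u
  step : ∀ {u v w} → E u v → Reach E v w → Reach E u w

Connected : ∀ {n} → (Fin (suc n) → Fin (suc n) → Set) → Set
Connected E = ∀ u v → Reach E u v

Bipartite : ∀ {n} → (Fin (suc n) → Fin (suc n) → Set) → Set
Bipartite {n} E = Σ (Fin (suc n) → Bool) λ c → ∀ u v → E u v → c u ≢ c v

CoConnected : ∀ {n} → (Fin (suc n) → Fin (suc n) → Set) → Set
CoConnected E = Connected (CoAdj E)

CoBipartite : ∀ {n} → (Fin (suc n) → Fin (suc n) → Set) → Set
CoBipartite E = Bipartite (CoAdj E)

-- Each closed neighbourhood N[B] = [B, F_r(B)] of a round graph is a clique, because
-- F_r is monotone along [B, F_r(B)]. If two closed neighbourhoods N[A] ∪ N[B] cover all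
-- semiblocks, colouring by membership in N[A] shows the complement is bipartite.
-- Otherwise, for every B the semiblock X just past N[B+1] is adjacent to neither B nor
-- B+1 (any arrow would make two neighbourhoods cover everything), so B, X, B+1 is a
-- walk in the complement, and the complement is connected.
module Submission where

open import Defs
open import Data.Nat using (ℕ; zero; suc; _+_; _∸_; _≤_; _<_; _%_; z≤n; s≤s; s≤s⁻¹; _≤?_; _<?_)
open import Data.Nat.Properties
open import Data.Nat.DivMod using (m%n<n; [m+n]%n≡m%n; m<n⇒m%n≡m; n%n≡0)
open import Data.Fin using (Fin; toℕ)
open import Data.Fin.Properties using (toℕ<n; toℕ-injective; toℕ-fromℕ<; any?; all?) renaming (_≟_ to _≟ᶠ_)
open import Data.Product using (_×_; _,_; ∃-syntax)
open import Data.Sum using (_⊎_; inj₁; inj₂; [_,_]′)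
open import Data.Empty using (⊥-elim)
open import Function using (id)
open import Relation.Nullary using (¬_; Dec; yes; no)
open import Relation.Nullary.Decidable using (_⊎-dec_; isYes)
open import Relation.Binary.PropositionalEquality

-- Moving t steps forward from x lands on y, wrapping around a cycle of length K at most once.
Offset : ℕ → ℕ → ℕ → ℕ → Set
Offset K x t y = x + t ≡ y ⊎ x + t ≡ y + K

Offset₂ : ℕ → ℕ → ℕ → ℕ → Set
Offset₂ K x s y = x + s ≡ y ⊎ x + s ≡ y + K ⊎ x + s ≡ y + (K + K)

module _ {K : ℕ} where
  open ≡-Reasoning

  offset-unique : ∀ {x y t t′} → t < K → t′ < K → Offset K x t y → Offset K x t′ y → t ≡ t′
  offset-unique {x} _ _ (inj₁ e) (inj₁ e′) = +-cancelˡ-≡ x _ _ (trans e (sym e′))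
  offset-unique {x} _ _ (inj₂ e) (inj₂ e′) = +-cancelˡ-≡ x _ _ (trans e (sym e′))
  offset-unique {x} {y} {t} {t′} _ t′<K (inj₁ e) (inj₂ e′) =
    ⊥-elim (<⇒≱ t′<K (subst (K ≤_) (sym t′≡t+K) (m≤n+m K t)))
    where
      t′≡t+K : t′ ≡ t + K
      t′≡t+K = +-cancelˡ-≡ x t′ (t + K) (begin
        x + t′      ≡⟨ e′ ⟩
        y + K       ≡⟨ cong (_+ K) (sym e) ⟩
        x + t + K   ≡⟨ +-assoc x t K ⟩
        x + (t + K) ∎)
  offset-unique t<K t′<K (inj₂ e) (inj₁ e′) = sym (offset-unique t′<K t<K (inj₁ e′) (inj₂ e))

  offset-injective : ∀ {x t u v} → u < K → v < K → Offset K x t u → Offset K x t v → u ≡ v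
  offset-injective _ _ (inj₁ e) (inj₁ e′) = trans (sym e) e′
  offset-injective {u = u} {v} u<K _ (inj₁ e) (inj₂ e′) =
    ⊥-elim (<⇒≱ u<K (subst (K ≤_) (trans (sym e′) e) (m≤n+m K v)))
  offset-injective {u = u} _ v<K (inj₂ e) (inj₁ e′) =
    ⊥-elim (<⇒≱ v<K (subst (K ≤_) (trans (sym e) e′) (m≤n+m K u)))
  offset-injective {u = u} {v} _ _ (inj₂ e) (inj₂ e′) = +-cancelʳ-≡ K u v (trans (sym e) e′)

  offset-trans : ∀ {a u v p q} → Offset K a p u → Offset K u q v → Offset₂ K a (p + q) v
  offset-trans {a} {u} {v} {p} {q} (inj₁ e₁) (inj₁ e₂) =
    inj₁ (trans (sym (+-assoc a p q)) (trans (cong (_+ q) e₁) e₂))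
  offset-trans {a} {u} {v} {p} {q} (inj₁ e₁) (inj₂ e₂) =
    inj₂ (inj₁ (trans (sym (+-assoc a p q)) (trans (cong (_+ q) e₁) e₂)))
  offset-trans {a} {u} {v} {p} {q} (inj₂ e₁) (inj₁ e₂) = inj₂ (inj₁ (begin
    a + (p + q)  ≡⟨ +-assoc a p q ⟨
    a + p + q    ≡⟨ cong (_+ q) e₁ ⟩
    u + K + q    ≡⟨ +-assoc u K q ⟩
    u + (K + q)  ≡⟨ cong (u +_) (+-comm K q) ⟩
    u + (q + K)  ≡⟨ +-assoc u q K ⟨
    u + q + K    ≡⟨ cong (_+ K) e₂ ⟩
    v + K        ∎))
  offset-trans {a} {u} {v} {p} {q} (inj₂ e₁) (inj₂ e₂) = inj₂ (inj₂ (begin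
    a + (p + q)  ≡⟨ +-assoc a p q ⟨
    a + p + q    ≡⟨ cong (_+ q) e₁ ⟩
    u + K + q    ≡⟨ +-assoc u K q ⟩
    u + (K + q)  ≡⟨ cong (u +_) (+-comm K q) ⟩
    u + (q + K)  ≡⟨ +-assoc u q K ⟨
    u + q + K    ≡⟨ cong (_+ K) e₂ ⟩
    v + K + K    ≡⟨ +-assoc v K K ⟩
    v + (K + K)  ∎))

  offset₂⇒offset : ∀ {a s v} → s < K → a < K → Offset₂ K a s v → Offset K a s v
  offset₂⇒offset _ _ (inj₁ e) = inj₁ e
  offset₂⇒offset _ _ (inj₂ (inj₁ e)) = inj₂ e
  offset₂⇒offset {a} {s} {v} s<K a<K (inj₂ (inj₂ e)) =
    ⊥-elim (<⇒≱ (+-mono-< a<K s<K) (subst (K + K ≤_) (sym e) (m≤n+m (K + K) v)))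

  offset₂-wrapped⇒offset : ∀ {a m v} → v < K → Offset₂ K a (m + K) v → Offset K a m v
  offset₂-wrapped⇒offset {a} {m} v<K (inj₁ e) =
    ⊥-elim (<⇒≱ v<K (subst (K ≤_) e (≤-trans (m≤n+m K m) (m≤n+m (m + K) a))))
  offset₂-wrapped⇒offset {a} {m} {v} _ (inj₂ (inj₁ e)) =
    inj₁ (+-cancelʳ-≡ K (a + m) v (trans (+-assoc a m K) e))
  offset₂-wrapped⇒offset {a} {m} {v} _ (inj₂ (inj₂ e)) =
    inj₂ (+-cancelʳ-≡ K (a + m) (v + K) (trans (+-assoc a m K) (trans e (sym (+-assoc v K K)))))

  m+K≡1+q⇒m≡0 : ∀ {m q} → q < K → suc q ≡ m + K → m ≡ 0
  m+K≡1+q⇒m≡0 {m} q<K e = n≤0⇒n≡0 (+-cancelʳ-≤ K m 0 (subst (_≤ K) e q<K))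

module _ {n : ℕ} where
  private
    K : ℕ
    K = suc n

  cdist< : ∀ (a u : Fin K) → cdist a u < K
  cdist< a u = m%n<n (toℕ u + K ∸ toℕ a) K

  cdist≤n : ∀ (a u : Fin K) → cdist a u ≤ n
  cdist≤n a u = s≤s⁻¹ (cdist< a u)

  cdist-offset : ∀ (a u : Fin K) → Offset K (toℕ a) (cdist a u) (toℕ u)
  cdist-offset a u with toℕ a ≤? toℕ u
  ... | yes a≤u = subst (λ t → Offset K (toℕ a) t (toℕ u)) (sym cdist≡u∸a) (inj₁ (m+[n∸m]≡n a≤u))
    where
      cdist≡u∸a : cdist a u ≡ toℕ u ∸ toℕ a
      cdist≡u∸a = trans (cong (_% K) (+-∸-comm K a≤u))
        (trans ([m+n]%n≡m%n (toℕ u ∸ toℕ a) K)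
          (m<n⇒m%n≡m (≤-<-trans (m∸n≤m (toℕ u) (toℕ a)) (toℕ<n u))))
  ... | no a≰u = subst (λ t → Offset K (toℕ a) t (toℕ u)) (sym (m<n⇒m%n≡m m<K))
                   (inj₂ (trans (+-comm (toℕ a) m) m+a≡u+K))
    where
      m = toℕ u + K ∸ toℕ a
      m+a≡u+K : m + toℕ a ≡ toℕ u + K
      m+a≡u+K = m∸n+n≡m (≤-trans (<⇒≤ (toℕ<n a)) (m≤n+m K (toℕ u)))
      m<K : m < K
      m<K = +-cancelʳ-< (toℕ a) m K (subst₂ _<_ (sym m+a≡u+K) (+-comm (toℕ a) K)
              (+-monoˡ-< K (≰⇒> a≰u)))

  cdist-unique : ∀ (a u : Fin K) {t} → t < K → Offset K (toℕ a) t (toℕ u) → cdist a u ≡ t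
  cdist-unique a u t<K o = offset-unique (cdist< a u) t<K (cdist-offset a u) o

  cdist-self : ∀ (a : Fin K) → cdist a a ≡ 0
  cdist-self a = cdist-unique a a (s≤s z≤n) (inj₁ (+-identityʳ (toℕ a)))

  cdist-injectiveʳ : ∀ (a : Fin K) {u v} → cdist a u ≡ cdist a v → u ≡ v
  cdist-injectiveʳ a {u} {v} e = toℕ-injective (offset-injective {x = toℕ a} (toℕ<n u) (toℕ<n v)
    (subst (λ t → Offset K (toℕ a) t (toℕ u)) e (cdist-offset a u)) (cdist-offset a v))

  cdist≡0⇒≡ : ∀ {a w : Fin K} → cdist a w ≡ 0 → a ≡ w
  cdist≡0⇒≡ {a} e = cdist-injectiveʳ a (trans (cdist-self a) (sym e))

  next-offset : ∀ (y : Fin K) → Offset K (toℕ y) 1 (toℕ (next y))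
  next-offset y with m≤n⇒m<n∨m≡n (toℕ<n y)
  ... | inj₁ 1+y<K = inj₁ (trans (+-comm (toℕ y) 1)
                       (sym (trans (toℕ-fromℕ< _) (m<n⇒m%n≡m 1+y<K))))
  ... | inj₂ 1+y≡K = inj₂ (trans (+-comm (toℕ y) 1) (trans 1+y≡K (cong (_+ K)
                       (sym (trans (toℕ-fromℕ< _) (trans (cong (_% K) 1+y≡K) (n%n≡0 K)))))))

  cdist-next-self : ∀ (y : Fin K) → cdist (next y) y ≡ n
  cdist-next-self y = cdist-unique (next y) y ≤-refl (back (next-offset y))
    where
      Y = toℕ y
      Y′ = toℕ (next y)
      back : Offset K Y 1 Y′ → Offset K Y′ n Y
      back (inj₁ e) = inj₂ (trans (cong (_+ n) (sym e)) (+-assoc Y 1 n))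
      back (inj₂ e) = inj₁ (suc-injective (trans (sym (+-suc Y′ n)) (trans (sym e) (+-comm Y 1))))

  cdist-of-offset₂ : ∀ (a v : Fin K) {s} → s < K + K → Offset₂ K (toℕ a) s (toℕ v) →
                     cdist a v ≡ s ⊎ ∃[ m ] (s ≡ m + K × cdist a v ≡ m)
  cdist-of-offset₂ a v {s} _ o with s <? K
  ... | yes s<K = inj₁ (cdist-unique a v s<K (offset₂⇒offset {a = toℕ a} s<K (toℕ<n a) o))
  cdist-of-offset₂ a v {s} s<2K o | no s≮K =
    inj₂ (m , s≡m+K , cdist-unique a v m<K
      (offset₂-wrapped⇒offset {a = toℕ a} (toℕ<n v)
        (subst (λ s → Offset₂ K (toℕ a) s (toℕ v)) s≡m+K o)))
    where
      m = s ∸ K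
      s≡m+K : s ≡ m + K
      s≡m+K = sym (m∸n+n≡m (≮⇒≥ s≮K))
      m<K : m < K
      m<K = +-cancelʳ-< K m K (subst (_< K + K) s≡m+K s<2K)

  cdist-compose : ∀ (a u v : Fin K) {p q} → p + q < K + K →
                  Offset K (toℕ a) p (toℕ u) → Offset K (toℕ u) q (toℕ v) →
                  cdist a v ≡ p + q ⊎ ∃[ m ] (p + q ≡ m + K × cdist a v ≡ m)
  cdist-compose a u v {p} s<2K o₁ o₂ =
    cdist-of-offset₂ a v s<2K (offset-trans {a = toℕ a} {p = p} o₁ o₂)

  cdist-additive : ∀ (a u v : Fin K) → cdist a u ≤ cdist a v → cdist a v ≡ cdist a u + cdist u v
  cdist-additive a u v au≤av
    with cdist-compose a u v (+-mono-< (cdist< a u) (cdist< u v)) (cdist-offset a u) (cdist-offset u v)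
  ... | inj₁ e = e
  ... | inj₂ (m , s≡m+K , av≡m) = ⊥-elim (<⇒≱ m<au (subst (cdist a u ≤_) av≡m au≤av))
    where
      m<au : m < cdist a u
      m<au = +-cancelʳ-< K m (cdist a u)
        (subst (_< cdist a u + K) s≡m+K (+-monoʳ-< (cdist a u) (cdist< u v)))

  cdist-+-flip : ∀ (a b : Fin K) → a ≢ b → cdist a b + cdist b a ≡ K
  cdist-+-flip a b a≢b
    with cdist-compose a b a (+-mono-< (cdist< a b) (cdist< b a)) (cdist-offset a b) (cdist-offset b a)
  ... | inj₁ e = ⊥-elim (a≢b (cdist≡0⇒≡ (m+n≡0⇒m≡0 (cdist a b) (trans (sym e) (cdist-self a)))))
  ... | inj₂ (m , s≡m+K , aa≡m) = trans s≡m+K (cong (_+ K) (trans (sym aa≡m) (cdist-self a)))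

  cdist-next-source : ∀ (u y : Fin K) → y ≢ u → cdist u y ≡ suc (cdist (next u) y)
  cdist-next-source u y y≢u
    with cdist-compose u (next u) y (+-mono-≤-< (s≤s z≤n) (cdist< (next u) y))
           (next-offset u) (cdist-offset (next u) y)
  ... | inj₁ e = e
  ... | inj₂ (m , s≡m+K , uy≡m) =
    ⊥-elim (y≢u (sym (cdist≡0⇒≡ (trans uy≡m (m+K≡1+q⇒m≡0 (cdist< (next u) y) s≡m+K)))))

  cdist-next-target : ∀ (a y : Fin K) → next y ≢ a → cdist a (next y) ≡ suc (cdist a y)
  cdist-next-target a y y+1≢a
    with cdist-compose a y (next y) (+-mono-<-≤ (cdist< a y) (s≤s z≤n)) (cdist-offset a y) (next-offset y)
  ... | inj₁ e = trans e (+-comm (cdist a y) 1)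
  ... | inj₂ (m , s≡m+K , e) = ⊥-elim (y+1≢a (sym (cdist≡0⇒≡
    (trans e (m+K≡1+q⇒m≡0 (cdist< a y) (trans (+-comm 1 (cdist a y)) s≡m+K))))))

  cdist-next-target-≤ : ∀ (a y : Fin K) → cdist a (next y) ≤ suc (cdist a y)
  cdist-next-target-≤ a y with next y ≟ᶠ a
  ... | yes refl = subst (_≤ suc (cdist a y)) (sym (cdist-self a)) z≤n
  ... | no y+1≢a = ≤-reflexive (cdist-next-target a y y+1≢a)

  cdist-next-source-≤ : ∀ {u y z : Fin K} → y ≢ u → z ≢ u →
                        cdist u y ≤ cdist u z → cdist (next u) y ≤ cdist (next u) z
  cdist-next-source-≤ {u} {y} {z} y≢u z≢u le =
    s≤s⁻¹ (subst₂ _≤_ (cdist-next-source u y y≢u) (cdist-next-source u z z≢u) le)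

  advance : Fin K → ℕ → Fin K
  advance a zero = a
  advance a (suc t) = next (advance a t)

  cdist-advance : ∀ (a : Fin K) t → t < K → cdist a (advance a t) ≡ t
  cdist-advance a zero _ = cdist-self a
  cdist-advance a (suc t) 1+t<K with next (advance a t) ≟ᶠ a
  ... | yes wraps = ⊥-elim (<-irrefl (cong suc (sym n≡t)) 1+t<K)
    where
      n≡t : n ≡ t
      n≡t = trans (sym (subst (λ b → cdist b (advance a t) ≡ n) wraps (cdist-next-self (advance a t))))
                  (cdist-advance a t (<-trans (n<1+n t) 1+t<K))
  ... | no ¬wraps = trans (cdist-next-target a (advance a t) ¬wraps)
                          (cong suc (cdist-advance a t (<-trans (n<1+n t) 1+t<K)))

  advance-cdist : ∀ (a u : Fin K) → advance a (cdist a u) ≡ u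
  advance-cdist a u = cdist-injectiveʳ a (cdist-advance a (cdist a u) (cdist< a u))

  interval-induction : ∀ {ℓ} (P : Fin K → Set ℓ) (a b : Fin K) → P a →
                       (∀ u → cdist a u < cdist a b → P u → P (next u)) →
                       ∀ v → InInterval a b v → P v
  interval-induction P a b base next-case v v∈ab = subst P (advance-cdist a v) (go (cdist a v) v∈ab)
    where
      go : ∀ t → t ≤ cdist a b → P (advance a t)
      go zero _ = base
      go (suc t) 1+t≤ab = next-case (advance a t) t<ab (go t (<⇒≤ 1+t≤ab))
        where
          t<ab : cdist a (advance a t) < cdist a b
          t<ab = subst (_< cdist a b)
            (sym (cdist-advance a t (≤-<-trans (<⇒≤ 1+t≤ab) (cdist< a b)))) 1+t≤ab

  Reach-trans : ∀ {E : Fin K → Fin K → Set} {u v w} → Reach E u v → Reach E v w → Reach E u w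
  Reach-trans here r = r
  Reach-trans (step e r) r′ = step e (Reach-trans r r′)

  Reach-next⇒Connected : ∀ {E : Fin K → Fin K → Set} → (∀ u → Reach E u (next u)) → Connected E
  Reach-next⇒Connected {E} reach-next u v = go (cdist u v) u refl
    where
      go : ∀ t u → cdist u v ≡ t → Reach E u v
      go zero u uv≡0 = subst (Reach E u) (cdist≡0⇒≡ uv≡0) here
      go (suc t) u uv≡1+t = Reach-trans (reach-next u)
        (go t (next u) (suc-injective (trans (sym (cdist-next-source u v v≢u)) uv≡1+t)))
        where
          v≢u : v ≢ u
          v≢u refl = 0≢1+n (trans (sym (cdist-self u)) uv≡1+t)

module Round {n : ℕ} (Φ : RoundRep n) where
  open RoundRep Φ renaming (Fr to F)

  private
    K : ℕ
    K = suc n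

  N[_] : Fin K → Fin K → Set
  N[ a ] = InInterval a (F a)

  N? : ∀ a v → Dec (N[ a ] v)
  N? a v = cdist a v ≤? cdist a (F a)

  N-self : ∀ a → N[ a ] a
  N-self a = subst (_≤ cdist a (F a)) (sym (cdist-self a)) z≤n

  F-monotone : ∀ a u → N[ a ] u → N[ u ] (F a)
  F-monotone a = interval-induction (λ u → N[ u ] (F a)) a (F a) ≤-refl F-monotone-next
    where
      F-monotone-next : ∀ u → cdist a u < cdist a (F a) → N[ u ] (F a) → N[ next u ] (F a)
      F-monotone-next u au<aFa Fa∈Nu = cdist-next-source-≤ Fa≢u Fu+1≢u Fa∈[u,Fu+1]
        where
          Fa≢u : F a ≢ u
          Fa≢u refl = <-irrefl refl au<aFa
          Fa∈[u,Fu+1] : cdist u (F a) ≤ cdist u (F (next u))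
          Fa∈[u,Fu+1] = ≤-trans Fa∈Nu (round u)
          Fu+1≢u : F (next u) ≢ u
          Fu+1≢u e = Fa≢u (sym (cdist≡0⇒≡ (n≤0⇒n≡0
            (subst (cdist u (F a) ≤_) (trans (cong (cdist u) e) (cdist-self u)) Fa∈[u,Fu+1]))))

  N-arrow : ∀ a u v → N[ a ] u → N[ a ] v → cdist a u ≤ cdist a v → v ≢ u → Arrow F u v
  N-arrow a u v u∈Na v∈Na au≤av v≢u = ≤-trans uv≤uFa (F-monotone a u u∈Na) , v≢u
    where
      uv≤uFa : cdist u v ≤ cdist u (F a)
      uv≤uFa = +-cancelˡ-≤ (cdist a u) (cdist u v) (cdist u (F a))
        (subst₂ _≤_ (cdist-additive a u v au≤av) (cdist-additive a u (F a) u∈Na) v∈Na)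

  N-clique : ∀ a u v → N[ a ] u → N[ a ] v → u ≢ v → Adj Φ u v
  N-clique a u v u∈Na v∈Na u≢v with ≤-total (cdist a u) (cdist a v)
  ... | inj₁ au≤av = inj₁ (N-arrow a u v u∈Na v∈Na au≤av (λ e → u≢v (sym e)))
  ... | inj₂ av≤au = inj₂ (N-arrow a v u v∈Na u∈Na av≤au u≢v)

  Cover : Fin K → Fin K → Set
  Cover a b = ∀ v → N[ a ] v ⊎ N[ b ] v

  Cover? : ∀ a b → Dec (Cover a b)
  Cover? a b = all? λ v → N? a v ⊎-dec N? b v

  -- The hypotheses say b ∈ [a, F a + 1] and a ∈ [b, F b + 1]: the two arcs leave no gap.
  mutual-reach⇒Cover : ∀ a b → a ≢ b → cdist b a ≤ suc (cdist b (F b)) →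
                       cdist a b ≤ suc (cdist a (F a)) → Cover a b
  mutual-reach⇒Cover a b a≢b ba≤ ab≤ v with N? a v
  ... | yes v∈Na = inj₁ v∈Na
  ... | no v∉Na = inj₂ (s≤s⁻¹ (≤-trans bv<ba ba≤))
    where
      ab≤av : cdist a b ≤ cdist a v
      ab≤av = ≤-trans ab≤ (≰⇒> v∉Na)
      bv<ba : cdist b v < cdist b a
      bv<ba = +-cancelˡ-< (cdist a b) (cdist b v) (cdist b a)
        (subst₂ _<_ (cdist-additive a b v ab≤av) (sym (cdist-+-flip a b a≢b)) (cdist< a v))

  N-full⇒Cover : ∀ a b → cdist a (F a) ≡ n → Cover a b
  N-full⇒Cover a b aFa≡n v = inj₁ (subst (cdist a v ≤_) (sym aFa≡n) (cdist≤n a v))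

  -- Here F (u + 1) is the predecessor of u, so N[u + 1] contains everything but u.
  N-prev⇒Cover : ∀ u → cdist u (F (next u)) ≡ n → Cover (next u) u
  N-prev⇒Cover u uw≡n v with v ≟ᶠ u
  ... | yes refl = inj₂ (N-self v)
  ... | no v≢u = inj₁ (cdist-next-source-≤ v≢u w≢u uv≤uw)
    where
      w = F (next u)
      uv≤uw : cdist u v ≤ cdist u w
      uv≤uw = subst (cdist u v ≤_) (sym uw≡n) (cdist≤n u v)
      w≢u : w ≢ u
      w≢u w≡u = v≢u (sym (cdist≡0⇒≡ (n≤0⇒n≡0
        (subst (cdist u v ≤_) (trans (cong (cdist u) w≡u) (cdist-self u)) uv≤uw))))

  Cover⇒CoBipartite : ∀ a b → Cover a b → CoBipartite (Adj Φ)
  Cover⇒CoBipartite a b cover = (λ v → isYes (N? a v)) , colouring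
    where
      N[b]-outside-N[a] : ∀ v → ¬ N[ a ] v → N[ b ] v
      N[b]-outside-N[a] v v∉Na = [ (λ v∈Na → ⊥-elim (v∉Na v∈Na)) , id ]′ (cover v)
      colouring : ∀ u v → CoAdj (Adj Φ) u v → isYes (N? a u) ≢ isYes (N? a v)
      colouring u v (u≢v , ¬adj) with N? a u | N? a v
      ... | yes u∈Na | yes v∈Na = λ _ → ¬adj (N-clique a u v u∈Na v∈Na u≢v)
      ... | yes _    | no _     = λ ()
      ... | no _     | yes _    = λ ()
      ... | no u∉Na  | no v∉Na  = λ _ → ¬adj (N-clique b u v
                                     (N[b]-outside-N[a] u u∉Na) (N[b]-outside-N[a] v v∉Na) u≢v)

  module NoCover (¬cover : ∀ a b → ¬ Cover a b) where

    -- The walk passes through x = F (u + 1) + 1, the first semiblock after N[u + 1].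
    co-walk-next : ∀ u → Reach (CoAdj (Adj Φ)) u (next u)
    co-walk-next u = step (u≢x , [ ¬u→x , ¬x→u ]′) (step (x≢u′ , [ ¬x→u′ , ¬u′→x ]′) here)
      where
        u′ = next u
        w = F u′
        x = next w
        x≢u′ : x ≢ u′
        x≢u′ x≡u′ = ¬cover u′ u′ (N-full⇒Cover u′ u′
          (subst (λ z → cdist z w ≡ n) x≡u′ (cdist-next-self w)))
        u≢x : u ≢ x
        u≢x u≡x = ¬cover u′ u (N-prev⇒Cover u
          (subst (λ z → cdist z w ≡ n) (sym u≡x) (cdist-next-self w)))
        u′x≡1+u′w : cdist u′ x ≡ suc (cdist u′ w)
        u′x≡1+u′w = cdist-next-target u′ w x≢u′
        ¬u′→x : ¬ Arrow F u′ x
        ¬u′→x (x∈Nu′ , _) = 1+n≰n (subst (_≤ cdist u′ w) u′x≡1+u′w x∈Nu′)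
        ¬x→u′ : ¬ Arrow F x u′
        ¬x→u′ (u′∈Nx , u′≢x) =
          ¬cover u′ x (mutual-reach⇒Cover u′ x u′≢x (m≤n⇒m≤1+n u′∈Nx) (≤-reflexive u′x≡1+u′w))
        ¬u→x : ¬ Arrow F u x
        ¬u→x (x∈Nu , x≢u) = 1+n≰n (subst (_≤ cdist u w) (cdist-next-target u w x≢u)
                                         (≤-trans x∈Nu (round u)))
        ¬x→u : ¬ Arrow F x u
        ¬x→u (u∈Nx , _) = ¬cover u′ x (mutual-reach⇒Cover u′ x (λ e → x≢u′ (sym e))
          (≤-trans (cdist-next-target-≤ x u) (s≤s u∈Nx)) (≤-reflexive u′x≡1+u′w))

    co-connected : CoConnected (Adj Φ)
    co-connected = Reach-next⇒Connected co-walk-next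

  co-bipartite-or-co-connected : CoBipartite (Adj Φ) ⊎ CoConnected (Adj Φ)
  co-bipartite-or-co-connected with any? (λ a → any? (Cover? a))
  ... | yes (a , b , cover) = inj₁ (Cover⇒CoBipartite a b cover)
  ... | no ¬cover = inj₂ (NoCover.co-connected λ a b cover → ¬cover (a , b , cover))

lemma17 : ∀ {n : ℕ} (Φ : RoundRep n) → ¬ CoConnected (Adj Φ) → CoBipartite (Adj Φ)
lemma17 Φ ¬co-connected =
  [ id , (λ c → ⊥-elim (¬co-connected c)) ]′ (Round.co-bipartite-or-co-connected Φ)
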